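{- For every constant $\delta>0$ there exists a complete bipartite correlation clustering instance whose integrality gap is at least $3-\delta$, i.e., the minimum cost of a clustering is at least $(3-\delta)$ times the optimal value of the LP relaxation.
   Context: A correlation clustering instance consists of a finite vertex set $V$ and a set $E$ of unordered pairs of distinct vertices, partitioned as $E=E^+\cup E^-$ into positive and negative edges. It is complete bipartite if $V=V_1\cup V_2$ (disjoint) and $E$ consists exactly of all pairs with one endpoint in $V_1$ and one in $V_2$; pairs within $V_1$ or within $V_2$ are neutral (impose no constraint). A clustering is a partition of $V$; its cost is the number of positive edges with endpoints in different parts plus the number of negative edges with both endpoints in the same part. The LP relaxation has real variables $x_{uv}=x_{vu}$ for all $u,v\in V$: minimize $\sum_{(u,v)\in E^+}x_{uv}+\sum_{(u,v)\in E^- }(1-x_{uv})$ subject to $x_{uv}+x_{vw}\ge x_{uw}$ for all $u,v,w\in V$, $x_{uu}=0$, $0\le x_{uv}\le 1$.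
   Formalization: The constant δ ranges over the positive rationals. -}

module Defs where

open import Data.Nat using (ℕ; zero; suc)
import Data.Nat as N
open import Data.Fin using (Fin; zero; suc)
open import Data.Sum using (_⊎_; inj₁; inj₂)
open import Data.Bool using (Bool; true; false; if_then_else_)
open import Data.Product using (_×_)
open import Data.Integer using (+_)
open import Data.Rational using (ℚ; 0ℚ; 1ℚ; _+_; _-_; _≤_; _/_)
open import Relation.Binary.PropositionalEquality using (_≡_)
open import Relation.Nullary using (Dec; yes; no)

Σℕ : (n : ℕ) → (Fin n → ℕ) → ℕ
Σℕ zero    f = 0
Σℕ (suc n) f = f zero N.+ Σℕ n (λ i → f (suc i))

Σℚ : (n : ℕ) → (Fin n → ℚ) → ℚ
Σℚ zero    f = 0ℚ
Σℚ (suc n) f = f zero + Σℚ n (λ i → f (suc i))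

ℕ→ℚ : ℕ → ℚ
ℕ→ℚ k = (+ k) / 1

-- Every pair (i , j) ∈ V₁ × V₂ is an edge;
-- sign i j = true means positive edge, false means negative edge.
-- Pairs inside V₁ or inside V₂ are neutral.
record CBInstance : Set where
  field
    n₁ n₂ : ℕ
    sign  : Fin n₁ → Fin n₂ → Bool

Vertex : CBInstance → Set
Vertex I = Fin (CBInstance.n₁ I) ⊎ Fin (CBInstance.n₂ I)

-- A clustering (partition of V) is given by a labelling of the
-- vertices: two vertices are in the same part iff they get the same label.
Clustering : CBInstance → Set
Clustering I = Vertex I → ℕ

edgeCost : Bool → ℕ → ℕ → ℕ
edgeCost s a b with a N.≟ b
edgeCost true  a b | yes _ = 0
edgeCost true  a b | no  _ = 1
edgeCost false a b | yes _ = 1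
edgeCost false a b | no  _ = 0

clusterCost : (I : CBInstance) → Clustering I → ℕ
clusterCost I c =
  Σℕ (CBInstance.n₁ I) λ i → Σℕ (CBInstance.n₂ I) λ j →
    edgeCost (CBInstance.sign I i j) (c (inj₁ i)) (c (inj₂ j))

LPFeasible : (I : CBInstance) → (Vertex I → Vertex I → ℚ) → Set
LPFeasible I x =
  (∀ u v → x u v ≡ x v u) ×
  (∀ u → x u u ≡ 0ℚ) ×
  (∀ u v → 0ℚ ≤ x u v) ×
  (∀ u v → x u v ≤ 1ℚ) ×
  (∀ u v w → x u w ≤ x u v + x v w)

LPObjective : (I : CBInstance) → (Vertex I → Vertex I → ℚ) → ℚ
LPObjective I x =
  Σℚ (CBInstance.n₁ I) λ i → Σℚ (CBInstance.n₂ I) λ j →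
    if CBInstance.sign I i j
      then x (inj₁ i) (inj₂ j)
      else 1ℚ - x (inj₁ i) (inj₂ j)

-- Let k = 9d with dδ ≥ 1, let the sides be the k³ lines y = mx + c (m < k, c < k²) and the
-- 2k³ points of the grid [k] × [2k²], and let incidences be the positive edges. Every line
-- carries exactly k points, so there are P = k⁴ positive edges, and two distinct lines meet
-- in at most one point.
--
-- Putting 1/3 on positive edges, 1 on negative edges and 2/3 between distinct vertices of
-- the same side is feasible, being a third of an integer-valued metric; its objective is P/3.
--
-- A clustering with K positive edges inside clusters and S pairs inside clusters costs
-- P + S − 2K. A cluster with a lines and b points contains at most (ab + a + b)/2
-- incidences: double counting pairs of lines through a point gives Σ_v deg(v)² ≤ K + a²,
-- and a·(2 deg(v)) + deg(v) ≤ deg(v)² + a² + a because deg(v) ≤ a. Summing over clusters,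
-- 2K ≤ S + |V|, so every clustering costs at least P − |V| = P − 3k³ ≥ (3 − δ)·P/3.

module Submission where

open import Defs
open import Data.Bool using (Bool; true; false; _∧_; T; if_then_else_)
import Data.Bool.Properties as Bool
open import Data.Empty using (⊥-elim)
open import Data.Fin using (Fin; zero; suc; toℕ; _↑ˡ_; _↑ʳ_; combine; remQuot)
import Data.Fin.Properties as Fin
open import Data.Product using (Σ; _×_; _,_; proj₁; proj₂; uncurry)
open import Data.Sum using (_⊎_; inj₁; inj₂)
open import Function using (_∘_; Equivalence)
open import Relation.Binary using (tri<; tri≈; tri>)
open import Relation.Binary.PropositionalEquality
open import Relation.Nullary using (yes; no; proof; ofʸ; ofⁿ)

module Rationals where

  open import Data.Nat as ℕ using (ℕ; zero; suc)
  import Data.Nat.Properties as ℕᵖ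
  open import Data.Integer as ℤ using (+_; +≤+; +<+)
  import Data.Integer.Properties as ℤ
  open import Data.Rational using (ℚ; mkℚ; 0ℚ; 1ℚ; _+_; _*_; _-_; -_; _≤_; _<_; _/_; toℚᵘ; NonNegative; nonNegative)
  import Data.Rational as ℚ
  open import Data.Rational.Properties
  open import Data.Rational.Unnormalised as ℚᵘ using (mkℚᵘ; *≡*; *≤*) renaming (_≃_ to _≃ᵘ_)
  import Data.Rational.Unnormalised.Properties as ℚᵘ
  open import Data.Rational.Solver using (module +-*-Solver)
  open import Data.Integer.Tactic.RingSolver as ℤ-Solver using ()
  open import Data.Nat.Tactic.RingSolver as ℕ-Solver using ()

  toℚᵘ-ℕ→ℚ : ∀ n → toℚᵘ (ℕ→ℚ n) ≃ᵘ mkℚᵘ (+ n) 0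
  toℚᵘ-ℕ→ℚ n = toℚᵘ-fromℚᵘ (mkℚᵘ (+ n) 0)

  ℕ→ℚ-+ : ∀ m n → ℕ→ℚ (m ℕ.+ n) ≡ ℕ→ℚ m + ℕ→ℚ n
  ℕ→ℚ-+ m n = toℚᵘ-injective (begin
    toℚᵘ (ℕ→ℚ (m ℕ.+ n))           ≈⟨ toℚᵘ-ℕ→ℚ (m ℕ.+ n) ⟩
    mkℚᵘ (+ (m ℕ.+ n)) 0           ≈⟨ *≡* (trans (cong (ℤ._* (+ 1 ℤ.* + 1)) (ℤ.pos-+ m n)) (identity (+ m) (+ n))) ⟩
    mkℚᵘ (+ m) 0 ℚᵘ.+ mkℚᵘ (+ n) 0 ≈⟨ ℚᵘ.+-cong (toℚᵘ-ℕ→ℚ m) (toℚᵘ-ℕ→ℚ n) ⟨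
    toℚᵘ (ℕ→ℚ m) ℚᵘ.+ toℚᵘ (ℕ→ℚ n) ≈⟨ toℚᵘ-homo-+ (ℕ→ℚ m) (ℕ→ℚ n) ⟨
    toℚᵘ (ℕ→ℚ m + ℕ→ℚ n)           ∎)
    where
    open ℚᵘ.≃-Reasoning
    identity : ∀ a b → (a ℤ.+ b) ℤ.* (+ 1 ℤ.* + 1) ≡ (a ℤ.* + 1 ℤ.+ b ℤ.* + 1) ℤ.* + 1
    identity = ℤ-Solver.solve-∀

  ℕ→ℚ-* : ∀ m n → ℕ→ℚ (m ℕ.* n) ≡ ℕ→ℚ m * ℕ→ℚ n
  ℕ→ℚ-* m n = toℚᵘ-injective (begin
    toℚᵘ (ℕ→ℚ (m ℕ.* n))           ≈⟨ toℚᵘ-ℕ→ℚ (m ℕ.* n) ⟩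
    mkℚᵘ (+ (m ℕ.* n)) 0           ≈⟨ *≡* (trans (cong (ℤ._* (+ 1 ℤ.* + 1)) (ℤ.pos-* m n)) (identity (+ m) (+ n))) ⟩
    mkℚᵘ (+ m) 0 ℚᵘ.* mkℚᵘ (+ n) 0 ≈⟨ ℚᵘ.*-cong (toℚᵘ-ℕ→ℚ m) (toℚᵘ-ℕ→ℚ n) ⟨
    toℚᵘ (ℕ→ℚ m) ℚᵘ.* toℚᵘ (ℕ→ℚ n) ≈⟨ toℚᵘ-homo-* (ℕ→ℚ m) (ℕ→ℚ n) ⟨
    toℚᵘ (ℕ→ℚ m * ℕ→ℚ n)           ∎)
    where
    open ℚᵘ.≃-Reasoning
    identity : ∀ a b → (a ℤ.* b) ℤ.* (+ 1 ℤ.* + 1) ≡ (a ℤ.* b) ℤ.* + 1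
    identity = ℤ-Solver.solve-∀

  ℕ→ℚ-mono-≤ : ∀ {m n} → m ℕ.≤ n → ℕ→ℚ m ≤ ℕ→ℚ n
  ℕ→ℚ-mono-≤ {m} {n} m≤n = toℚᵘ-cancel-≤
    (ℚᵘ.≤-respˡ-≃ (ℚᵘ.≃-sym (toℚᵘ-ℕ→ℚ m)) (ℚᵘ.≤-respʳ-≃ (ℚᵘ.≃-sym (toℚᵘ-ℕ→ℚ n))
      (*≤* (ℤ.*-monoʳ-≤-nonNeg (+ 1) (+≤+ m≤n)))))

  ℕ→ℚ-nonNeg : ∀ n → NonNegative (ℕ→ℚ n)
  ℕ→ℚ-nonNeg n = nonNegative (ℕ→ℚ-mono-≤ {0} {n} ℕ.z≤n)

  ⅓ : ℚ
  ⅓ = + 1 / 3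

  thirds : ℕ → ℚ
  thirds n = ℕ→ℚ n * ⅓

  thirds-+ : ∀ m n → thirds (m ℕ.+ n) ≡ thirds m + thirds n
  thirds-+ m n = trans (cong (_* ⅓) (ℕ→ℚ-+ m n)) (*-distribʳ-+ ⅓ (ℕ→ℚ m) (ℕ→ℚ n))

  thirds-mono-≤ : ∀ {m n} → m ℕ.≤ n → thirds m ≤ thirds n
  thirds-mono-≤ m≤n = *-monoʳ-≤-nonNeg ⅓ (ℕ→ℚ-mono-≤ m≤n)

  0<thirds : ∀ {n} → 1 ℕ.≤ n → 0ℚ < thirds n
  0<thirds 1≤n = <-≤-trans (ℚ.*<* (+<+ (ℕ.s≤s ℕ.z≤n))) (thirds-mono-≤ 1≤n)

  thirds-3* : ∀ n → thirds (3 ℕ.* n) ≡ ℕ→ℚ n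
  thirds-3* n = begin
    ℕ→ℚ (3 ℕ.* n) * ⅓    ≡⟨ cong (_* ⅓) (ℕ→ℚ-* 3 n) ⟩
    ℕ→ℚ 3 * ℕ→ℚ n * ⅓    ≡⟨ solve 3 (λ t x h → t :* x :* h := x :* (t :* h)) refl (ℕ→ℚ 3) (ℕ→ℚ n) ⅓ ⟩
    ℕ→ℚ n * (ℕ→ℚ 3 * ⅓)  ≡⟨ *-identityʳ (ℕ→ℚ n) ⟩
    ℕ→ℚ n                ∎
    where
    open ≡-Reasoning
    open +-*-Solver

  Σℚ-thirds : ∀ n {g : Fin n → ℚ} (f : Fin n → ℕ) → (∀ i → g i ≡ thirds (f i)) → Σℚ n g ≡ thirds (Σℕ n f)
  Σℚ-thirds zero f _ = refl
  Σℚ-thirds (suc n) f g≡thirds =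
    trans (cong₂ _+_ (g≡thirds zero) (Σℚ-thirds n (f ∘ suc) (g≡thirds ∘ suc)))
          (sym (thirds-+ (f zero) (Σℕ n (f ∘ suc))))

  archimedean : ∀ δ → 0ℚ < δ → Σ ℕ λ d → 1ℚ ≤ δ * ℕ→ℚ (suc d)
  -- δ = (p + 1)/(d + 1), so δ · (d + 1) = p + 1.
  archimedean δ@(mkℚ ℤ.+[1+ p ] d _) _ = d , toℚᵘ-cancel-≤ (ℚᵘ.≤-respʳ-≃
    (ℚᵘ.≃-sym (ℚᵘ.≃-trans (toℚᵘ-homo-* δ (ℕ→ℚ (suc d))) (ℚᵘ.*-congˡ {toℚᵘ δ} (toℚᵘ-ℕ→ℚ (suc d)))))
    (*≤* (+≤+ (ℕ.s≤s (subst₂ ℕ._≤_ (left d) (right d p) (ℕᵖ.m≤m+n d (p ℕ.* suc d)))))))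
    where
    left : ∀ d → d ≡ d ℕ.* 1 ℕ.+ 0 ℕ.* suc (d ℕ.* 1)
    left = ℕ-Solver.solve-∀
    right : ∀ d p → d ℕ.+ p ℕ.* suc d ≡ (d ℕ.+ p ℕ.* suc d) ℕ.* 1
    right = ℕ-Solver.solve-∀
  archimedean (mkℚ (+ 0) _ _) (ℚ.*<* (+<+ ()))
  archimedean (mkℚ ℤ.-[1+ _ ] _ _) (ℚ.*<* ())

  gap-bound : ∀ {δ d n P C} → 1ℚ ≤ δ * ℕ→ℚ d → P ≡ 3 ℕ.* (d ℕ.* n) → P ℕ.≤ C ℕ.+ n →
              (ℕ→ℚ 3 - δ) * thirds P ≤ ℕ→ℚ C
  gap-bound {δ} {d} {n} {P} {C} 1≤δd refl P≤C+n = begin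
    (ℕ→ℚ 3 - δ) * thirds P
      ≡⟨ cong ((ℕ→ℚ 3 - δ) *_) (trans (thirds-3* (d ℕ.* n)) (ℕ→ℚ-* d n)) ⟩
    (ℕ→ℚ 3 - δ) * (D * N)
      ≡⟨ solve 4 (λ t δ D N → (t :- δ) :* (D :* N) := t :* (D :* N) :- δ :* D :* N) refl (ℕ→ℚ 3) δ D N ⟩
    ℕ→ℚ 3 * (D * N) - δ * D * N
      ≤⟨ +-monoʳ-≤ (ℕ→ℚ 3 * (D * N)) (neg-antimono-≤ (*-monoʳ-≤-nonNeg N {{ℕ→ℚ-nonNeg n}} 1≤δd)) ⟩
    ℕ→ℚ 3 * (D * N) - 1ℚ * N
      ≡⟨ cong₂ _-_ (sym (trans (ℕ→ℚ-* 3 (d ℕ.* n)) (cong (ℕ→ℚ 3 *_) (ℕ→ℚ-* d n)))) (*-identityˡ N) ⟩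
    ℕ→ℚ P - N
      ≤⟨ +-monoˡ-≤ (- N) (≤-trans (ℕ→ℚ-mono-≤ P≤C+n) (≤-reflexive (ℕ→ℚ-+ C n))) ⟩
    ℕ→ℚ C + N - N
      ≡⟨ solve 2 (λ c N → c :+ N :- N := c) refl (ℕ→ℚ C) N ⟩
    ℕ→ℚ C ∎
    where
    open ≤-Reasoning
    open +-*-Solver
    D N : ℚ
    D = ℕ→ℚ d
    N = ℕ→ℚ n

module Counting where

  open import Data.Nat using (ℕ; zero; suc; _+_; _*_; _≤_; _<_; z≤n; s≤s; _≟_; _≡ᵇ_)
  open import Data.Nat.Properties
  open import Data.Nat.Tactic.RingSolver using (solve-∀)
  import Data.Rational as ℚ
  import Data.Rational.Properties as ℚ
  open import Algebra.Properties.Semiring.Sum +-*-semiring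
    using (sum; sum-syntax; sum-cong-≗; sum-replicate-zero; ∑-comm; ∑-distrib-+; *-distribˡ-sum; *-distribʳ-sum)
  open Rationals using (thirds; thirds-+; thirds-mono-≤; Σℚ-thirds)

  ⟦_⟧ : Bool → ℕ
  ⟦ true ⟧ = 1
  ⟦ false ⟧ = 0

  ⟦⟧≤1 : ∀ b → ⟦ b ⟧ ≤ 1
  ⟦⟧≤1 true = ≤-refl
  ⟦⟧≤1 false = z≤n

  ⟦⟧-idem : ∀ b → ⟦ b ⟧ * ⟦ b ⟧ ≡ ⟦ b ⟧
  ⟦⟧-idem true = refl
  ⟦⟧-idem false = refl

  ⟦∧⟧ : ∀ a b → ⟦ a ∧ b ⟧ ≡ ⟦ a ⟧ * ⟦ b ⟧
  ⟦∧⟧ true b = sym (+-identityʳ ⟦ b ⟧)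
  ⟦∧⟧ false b = refl

  ≡ᵇ-refl : ∀ n → (n ≡ᵇ n) ≡ true
  ≡ᵇ-refl zero = refl
  ≡ᵇ-refl (suc n) = ≡ᵇ-refl n

  ≡ᵇ-sym : ∀ m n → (m ≡ᵇ n) ≡ (n ≡ᵇ m)
  ≡ᵇ-sym zero zero = refl
  ≡ᵇ-sym zero (suc n) = refl
  ≡ᵇ-sym (suc m) zero = refl
  ≡ᵇ-sym (suc m) (suc n) = ≡ᵇ-sym m n

  ≢⇒≡ᵇ≡false : ∀ {m n} → m ≢ n → (m ≡ᵇ n) ≡ false
  ≢⇒≡ᵇ≡false {m} {n} m≢n with m ≡ᵇ n | proof (m ≟ n)
  ... | false | _ = refl
  ... | true | ofʸ m≡n = ⊥-elim (m≢n m≡n)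

  Σℕ≗sum : ∀ n (f : Fin n → ℕ) → Σℕ n f ≡ sum f
  Σℕ≗sum zero f = refl
  Σℕ≗sum (suc n) f = cong (f zero +_) (Σℕ≗sum n (f ∘ suc))

  Σℕ²≡∑∑ : ∀ {m n} (f : Fin m → Fin n → ℕ) → Σℕ m (λ i → Σℕ n (f i)) ≡ ∑[ i < m ] ∑[ j < n ] f i j
  Σℕ²≡∑∑ {m} {n} f = trans (Σℕ≗sum m (λ i → Σℕ n (f i))) (sum-cong-≗ λ i → Σℕ≗sum n (f i))

  sum-mono-≤ : ∀ {n} {f g : Fin n → ℕ} → (∀ i → f i ≤ g i) → sum f ≤ sum g
  sum-mono-≤ {zero} f≤g = z≤n
  sum-mono-≤ {suc n} f≤g = +-mono-≤ (f≤g zero) (sum-mono-≤ (f≤g ∘ suc))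

  sum-const : ∀ n c → ∑[ i < n ] c ≡ n * c
  sum-const zero c = refl
  sum-const (suc n) c = cong (c +_) (sum-const n c)

  sum-*-sum : ∀ {m n} (f : Fin m → ℕ) (g : Fin n → ℕ) → sum f * sum g ≡ ∑[ i < m ] ∑[ j < n ] (f i * g j)
  sum-*-sum f g = trans (*-distribʳ-sum (sum g) f) (sum-cong-≗ λ i → *-distribˡ-sum (f i) g)

  ∑∑-distrib-+ : ∀ {m n} (f g : Fin m → Fin n → ℕ) →
    ∑[ i < m ] ∑[ j < n ] (f i j + g i j) ≡ ∑[ i < m ] ∑[ j < n ] f i j + ∑[ i < m ] ∑[ j < n ] g i j
  ∑∑-distrib-+ f g =
    trans (sum-cong-≗ λ i → ∑-distrib-+ (f i) (g i)) (∑-distrib-+ (λ i → sum (f i)) (λ i → sum (g i)))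

  ≤-sum : ∀ {n} (f : Fin n → ℕ) i → f i ≤ sum f
  ≤-sum f zero = m≤m+n (f zero) _
  ≤-sum f (suc i) = ≤-trans (≤-sum (f ∘ suc) i) (m≤n+m _ (f zero))

  sum-indicator : ∀ {n} t (h : ℕ → ℕ) → t < n → ∑[ j < n ] (⟦ t ≡ᵇ toℕ j ⟧ * h (toℕ j)) ≡ h t
  sum-indicator {suc n} zero h _ =
    trans (cong₂ _+_ (*-identityˡ (h 0)) (sum-replicate-zero n)) (+-identityʳ (h 0))
  sum-indicator {suc n} (suc t) h (s≤s t<n) = sum-indicator t (h ∘ suc) t<n

  sum-indicator-1 : ∀ {n} t → t < n → ∑[ j < n ] ⟦ t ≡ᵇ toℕ j ⟧ ≡ 1
  sum-indicator-1 {n} t t<n =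
    trans (sum-cong-≗ {n} λ j → sym (*-identityʳ ⟦ t ≡ᵇ toℕ j ⟧)) (sum-indicator t (λ _ → 1) t<n)

  sum-unique≤1 : ∀ {n} (p : Fin n → Bool) → (∀ i j → T (p i) → T (p j) → i ≡ j) → ∑[ i < n ] ⟦ p i ⟧ ≤ 1
  sum-unique≤1 {zero} p unique = z≤n
  sum-unique≤1 {suc n} p unique with p zero in p₀
  ... | true = ≤-reflexive (cong suc (trans (sum-cong-≗ rest-false) (sum-replicate-zero n)))
    where
    rest-false : ∀ i → ⟦ p (suc i) ⟧ ≡ 0
    rest-false i with p (suc i) in pᵢ
    ... | false = refl
    ... | true with () ← unique zero (suc i) (subst T (sym p₀) _) (subst T (sym pᵢ) _)
  ... | false = sum-unique≤1 (p ∘ suc) λ i j pᵢ pⱼ → Fin.suc-injective (unique (suc i) (suc j) pᵢ pⱼ)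

  sum-↑ : ∀ m {n} (f : Fin (m + n) → ℕ) → sum f ≡ ∑[ i < m ] f (i ↑ˡ n) + ∑[ j < n ] f (m ↑ʳ j)
  sum-↑ zero f = refl
  sum-↑ (suc m) f = trans (cong (f zero +_) (sum-↑ m (f ∘ suc))) (sym (+-assoc (f zero) _ _))

  sum-combine : ∀ m n (f : Fin (m * n) → ℕ) → sum f ≡ ∑[ i < m ] ∑[ j < n ] f (combine i j)
  sum-combine zero n f = refl
  sum-combine (suc m) n f = trans (sum-↑ n f)
    (cong (∑[ j < n ] f (j ↑ˡ (m * n)) +_) (sum-combine m n (λ z → f (n ↑ʳ z))))

  -- Linear incidence structures

  Linear : ∀ {m n} → (Fin m → Fin n → Bool) → Set
  Linear {m} {n} inc = ∀ {u u'} → u ≢ u' → ∑[ v < n ] ⟦ inc u v ∧ inc u' v ⟧ ≤ 1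

  size : ∀ {n} → (Fin n → Bool) → ℕ
  size {n} A = ∑[ u < n ] ⟦ A u ⟧

  incidences : ∀ {m n} → (Fin m → Fin n → Bool) → (Fin m → Bool) → (Fin n → Bool) → ℕ
  incidences {m} {n} inc A B = ∑[ u < m ] ∑[ v < n ] ⟦ A u ∧ (B v ∧ inc u v) ⟧

  -- (m − n)² + (m − n) ≥ 0
  m*[2n]+n≤n*n+[m*m+m] : ∀ {m n} → n ≤ m → m * (2 * n) + n ≤ n * n + (m * m + m)
  m*[2n]+n≤n*n+[m*m+m] {m} {n} n≤m with d , refl ← m≤n⇒∃[o]m+o≡n n≤m =
    ≤-trans (m≤m+n _ (d * d + d)) (≤-reflexive (identity n d))
    where
    identity : ∀ n d → ((n + d) * (2 * n) + n) + (d * d + d) ≡ n * n + ((n + d) * (n + d) + (n + d))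
    identity = solve-∀

  *-cancelˡ-≤-unless-0 : ∀ a {x y} → a * x ≤ a * y → (a ≡ 0 → x ≡ 0) → x ≤ y
  *-cancelˡ-≤-unless-0 zero _ x≡0 = ≤-trans (≤-reflexive (x≡0 refl)) z≤n
  *-cancelˡ-≤-unless-0 (suc a) ax≤ay _ = *-cancelˡ-≤ (suc a) ax≤ay

  ⟦∧⟧*⟦∧⟧≤ : ∀ a a' b i i' → ⟦ a ∧ (b ∧ i) ⟧ * ⟦ a' ∧ (b ∧ i') ⟧ ≤ ⟦ a ∧ a' ⟧ * ⟦ i ∧ i' ⟧
  ⟦∧⟧*⟦∧⟧≤ false _ _ _ _ = z≤n
  ⟦∧⟧*⟦∧⟧≤ true _ false _ _ = z≤n
  ⟦∧⟧*⟦∧⟧≤ true _ true false _ = z≤n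
  ⟦∧⟧*⟦∧⟧≤ true false true true _ = z≤n
  ⟦∧⟧*⟦∧⟧≤ true true true true _ = ≤-refl

  module _ {m n} {inc : Fin m → Fin n → Bool} (linear : Linear inc) (A : Fin m → Bool) (B : Fin n → Bool) where

    private
      χ : Fin m → Fin n → ℕ
      χ u v = ⟦ A u ∧ (B v ∧ inc u v) ⟧

      a K : ℕ
      a = size A
      K = incidences inc A B

      degree : Fin n → ℕ
      degree v = ∑[ u < m ] χ u v

      row : Fin m → ℕ
      row u = ∑[ v < n ] χ u v

      degree≤a : ∀ v → degree v ≤ a
      degree≤a v = sum-mono-≤ χ≤A
        where
        χ≤A : ∀ u → χ u v ≤ ⟦ A u ⟧
        χ≤A u with A u
        ... | true = ⟦⟧≤1 _
        ... | false = z≤n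

      degree-outside : ∀ v → B v ≡ false → degree v ≡ 0
      degree-outside v Bv≡false = trans (sum-cong-≗ χ≡0) (sum-replicate-zero m)
        where
        χ≡0 : ∀ u → χ u v ≡ 0
        χ≡0 u rewrite Bv≡false with A u
        ... | true = refl
        ... | false = refl

      K≡∑degree : K ≡ ∑[ v < n ] degree v
      K≡∑degree = ∑-comm χ

      per-point : ∀ v → a * (2 * degree v) + degree v ≤ degree v * degree v + ⟦ B v ⟧ * (a * a + a)
      per-point v = by-membership (B v) refl
        where
        by-membership : ∀ b → B v ≡ b → a * (2 * degree v) + degree v ≤ degree v * degree v + ⟦ b ⟧ * (a * a + a)
        by-membership true _ = ≤-trans (m*[2n]+n≤n*n+[m*m+m] (degree≤a v))
          (≤-reflexive (cong (degree v * degree v +_) (sym (+-identityʳ _))))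
        by-membership false Bv≡false rewrite degree-outside v Bv≡false | *-zeroʳ a = ≤-refl

      summed-over-points : a * (2 * K) + K ≤ ∑[ v < n ] (degree v * degree v) + size B * (a * a + a)
      summed-over-points = begin
        a * (2 * K) + K
          ≡⟨ cong (λ k → a * (2 * k) + k) K≡∑degree ⟩
        a * (2 * ∑[ v < n ] degree v) + ∑[ v < n ] degree v
          ≡⟨ cong (_+ ∑[ v < n ] degree v)
               (trans (cong (a *_) (*-distribˡ-sum 2 degree)) (*-distribˡ-sum a (λ v → 2 * degree v))) ⟩
        ∑[ v < n ] (a * (2 * degree v)) + ∑[ v < n ] degree v
          ≡⟨ ∑-distrib-+ (λ v → a * (2 * degree v)) degree ⟨
        ∑[ v < n ] (a * (2 * degree v) + degree v)
          ≤⟨ sum-mono-≤ per-point ⟩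
        ∑[ v < n ] (degree v * degree v + ⟦ B v ⟧ * (a * a + a))
          ≡⟨ ∑-distrib-+ (λ v → degree v * degree v) (λ v → ⟦ B v ⟧ * (a * a + a)) ⟩
        ∑[ v < n ] (degree v * degree v) + ∑[ v < n ] (⟦ B v ⟧ * (a * a + a))
          ≡⟨ cong (∑[ v < n ] (degree v * degree v) +_) (*-distribʳ-sum (a * a + a) (⟦_⟧ ∘ B)) ⟨
        ∑[ v < n ] (degree v * degree v) + size B * (a * a + a) ∎
        where open ≤-Reasoning

      codegree≤ : ∀ u u' → ∑[ v < n ] (χ u v * χ u' v) ≤ ⟦ toℕ u ≡ᵇ toℕ u' ⟧ * row u + ⟦ A u ⟧ * ⟦ A u' ⟧
      codegree≤ u u' with toℕ u ≡ᵇ toℕ u' | proof (toℕ u ≟ toℕ u')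
      ... | true | ofʸ eq with refl ← Fin.toℕ-injective eq = ≤-trans
        (≤-reflexive (trans (sum-cong-≗ λ v → ⟦⟧-idem (A u ∧ (B v ∧ inc u v))) (sym (+-identityʳ (row u)))))
        (m≤m+n _ _)
      ... | false | ofⁿ toℕu≢toℕu' = begin
        ∑[ v < n ] (χ u v * χ u' v)
          ≤⟨ sum-mono-≤ (λ v → ⟦∧⟧*⟦∧⟧≤ (A u) (A u') (B v) (inc u v) (inc u' v)) ⟩
        ∑[ v < n ] (⟦ A u ∧ A u' ⟧ * ⟦ inc u v ∧ inc u' v ⟧)
          ≡⟨ *-distribˡ-sum ⟦ A u ∧ A u' ⟧ (λ v → ⟦ inc u v ∧ inc u' v ⟧) ⟨
        ⟦ A u ∧ A u' ⟧ * ∑[ v < n ] ⟦ inc u v ∧ inc u' v ⟧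
          ≤⟨ *-monoʳ-≤ ⟦ A u ∧ A u' ⟧ (linear (toℕu≢toℕu' ∘ cong toℕ)) ⟩
        ⟦ A u ∧ A u' ⟧ * 1
          ≡⟨ trans (*-identityʳ _) (⟦∧⟧ (A u) (A u')) ⟩
        ⟦ A u ⟧ * ⟦ A u' ⟧ ∎
        where open ≤-Reasoning

      ∑degree²≤ : ∑[ v < n ] (degree v * degree v) ≤ K + a * a
      ∑degree²≤ = begin
        ∑[ v < n ] (degree v * degree v)
          ≡⟨ sum-cong-≗ (λ v → sum-*-sum (λ u → χ u v) (λ u → χ u v)) ⟩
        ∑[ v < n ] ∑[ u < m ] ∑[ u' < m ] (χ u v * χ u' v)
          ≡⟨ ∑-comm (λ v u → ∑[ u' < m ] (χ u v * χ u' v)) ⟩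
        ∑[ u < m ] ∑[ v < n ] ∑[ u' < m ] (χ u v * χ u' v)
          ≡⟨ sum-cong-≗ (λ u → ∑-comm (λ v u' → χ u v * χ u' v)) ⟩
        ∑[ u < m ] ∑[ u' < m ] ∑[ v < n ] (χ u v * χ u' v)
          ≤⟨ sum-mono-≤ (λ u → sum-mono-≤ (codegree≤ u)) ⟩
        ∑[ u < m ] ∑[ u' < m ] (⟦ toℕ u ≡ᵇ toℕ u' ⟧ * row u + ⟦ A u ⟧ * ⟦ A u' ⟧)
          ≡⟨ sum-cong-≗ (λ u → ∑-distrib-+ (λ u' → ⟦ toℕ u ≡ᵇ toℕ u' ⟧ * row u) (λ u' → ⟦ A u ⟧ * ⟦ A u' ⟧)) ⟩
        ∑[ u < m ] (∑[ u' < m ] (⟦ toℕ u ≡ᵇ toℕ u' ⟧ * row u) + ∑[ u' < m ] (⟦ A u ⟧ * ⟦ A u' ⟧))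
          ≡⟨ sum-cong-≗ (λ u → cong₂ _+_ (sum-indicator (toℕ u) (λ _ → row u) (Fin.toℕ<n u))
                                          (sym (*-distribˡ-sum ⟦ A u ⟧ (⟦_⟧ ∘ A)))) ⟩
        ∑[ u < m ] (row u + ⟦ A u ⟧ * a)
          ≡⟨ ∑-distrib-+ row (λ u → ⟦ A u ⟧ * a) ⟩
        K + ∑[ u < m ] (⟦ A u ⟧ * a)
          ≡⟨ cong (K +_) (*-distribʳ-sum a (⟦_⟧ ∘ A)) ⟨
        K + a * a ∎
        where open ≤-Reasoning

      no-lines⇒no-incidences : a ≡ 0 → 2 * K ≡ 0
      no-lines⇒no-incidences a≡0 = cong (2 *_) (n≤0⇒n≡0 (begin
        K                   ≡⟨ K≡∑degree ⟩
        ∑[ v < n ] degree v ≤⟨ sum-mono-≤ degree≤a ⟩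
        ∑[ v < n ] a        ≡⟨ sum-const n a ⟩
        n * a               ≡⟨ cong (n *_) a≡0 ⟩
        n * 0               ≡⟨ *-zeroʳ n ⟩
        0                   ∎))
        where open ≤-Reasoning

    incidences-bound : 2 * incidences inc A B ≤ size A * size B + size A + size B
    incidences-bound = *-cancelˡ-≤-unless-0 a (+-cancelˡ-≤ K _ _ (begin
      K + a * (2 * K)                                    ≡⟨ +-comm K _ ⟩
      a * (2 * K) + K                                    ≤⟨ summed-over-points ⟩
      ∑[ v < n ] (degree v * degree v) + b * (a * a + a) ≤⟨ +-monoˡ-≤ _ ∑degree²≤ ⟩
      K + a * a + b * (a * a + a)                        ≡⟨ identity K a b ⟩
      K + a * (a * b + a + b)                            ∎)) no-lines⇒no-incidences
      where
      open ≤-Reasoning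
      b : ℕ
      b = size B
      identity : ∀ K a b → K + a * a + b * (a * a + a) ≡ K + a * (a * b + a + b)
      identity = solve-∀

  -- Clusterings of a bipartite instance with linear positive edges

  edgeCost-identity : ∀ s a b → edgeCost s a b + 2 * ⟦ (a ≡ᵇ b) ∧ s ⟧ ≡ ⟦ s ⟧ + ⟦ a ≡ᵇ b ⟧
  edgeCost-identity s a b with a ≟ b
  edgeCost-identity true  a .a | yes refl rewrite ≡ᵇ-refl a = refl
  edgeCost-identity false a .a | yes refl rewrite ≡ᵇ-refl a = refl
  edgeCost-identity true  a b  | no a≢b rewrite ≢⇒≡ᵇ≡false a≢b = refl
  edgeCost-identity false a b  | no a≢b rewrite ≢⇒≡ᵇ≡false a≢b = refl

  sum-sameLabel : ∀ {M} x y (h : Bool → ℕ) → x < M →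
    ∑[ l < M ] (⟦ x ≡ᵇ toℕ l ⟧ * h (y ≡ᵇ toℕ l)) ≡ h (x ≡ᵇ y)
  sum-sameLabel x y h x<M = trans (sum-indicator x (h ∘ (y ≡ᵇ_)) x<M) (cong h (≡ᵇ-sym y x))

  ∑-cluster-sizes : ∀ {n M} (c : Fin n → ℕ) → (∀ u → c u < M) → ∑[ l < M ] ∑[ u < n ] ⟦ c u ≡ᵇ toℕ l ⟧ ≡ n
  ∑-cluster-sizes {n} {M} c c<M = begin
    ∑[ l < M ] ∑[ u < n ] ⟦ c u ≡ᵇ toℕ l ⟧ ≡⟨ ∑-comm (λ (l : Fin M) u → ⟦ c u ≡ᵇ toℕ l ⟧) ⟩
    ∑[ u < n ] ∑[ l < M ] ⟦ c u ≡ᵇ toℕ l ⟧ ≡⟨ sum-cong-≗ (λ u → sum-indicator-1 (c u) (c<M u)) ⟩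
    ∑[ u < n ] 1                          ≡⟨ sum-const n 1 ⟩
    n * 1                                 ≡⟨ *-identityʳ n ⟩
    n                                     ∎
    where open ≡-Reasoning

  module _ {n₁ n₂} {pos : Fin n₁ → Fin n₂ → Bool} (linear : Linear pos) (c₁ : Fin n₁ → ℕ) (c₂ : Fin n₂ → ℕ) where

    private
      cost P K S M : ℕ
      cost = ∑[ u < n₁ ] ∑[ v < n₂ ] edgeCost (pos u v) (c₁ u) (c₂ v)
      P = ∑[ u < n₁ ] ∑[ v < n₂ ] ⟦ pos u v ⟧
      K = ∑[ u < n₁ ] ∑[ v < n₂ ] ⟦ (c₁ u ≡ᵇ c₂ v) ∧ pos u v ⟧
      S = ∑[ u < n₁ ] ∑[ v < n₂ ] ⟦ c₁ u ≡ᵇ c₂ v ⟧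
      -- Labels are arbitrary naturals, but all those in use are below M, so the clusters
      -- are the classes of the labels l < M (most of them empty).
      M = suc (sum c₁ + sum c₂)

      c₁<M : ∀ u → c₁ u < M
      c₁<M u = s≤s (≤-trans (≤-sum c₁ u) (m≤m+n _ _))

      c₂<M : ∀ v → c₂ v < M
      c₂<M v = s≤s (≤-trans (≤-sum c₂ v) (m≤n+m _ _))

      cluster₁ : Fin M → Fin n₁ → Bool
      cluster₁ l u = c₁ u ≡ᵇ toℕ l

      cluster₂ : Fin M → Fin n₂ → Bool
      cluster₂ l v = c₂ v ≡ᵇ toℕ l

      cost+2K≡P+S : cost + 2 * K ≡ P + S
      cost+2K≡P+S = begin
        cost + 2 * K
          ≡⟨ cong (cost +_) (trans (*-distribˡ-sum 2 (λ u → ∑[ v < n₂ ] ⟦ (c₁ u ≡ᵇ c₂ v) ∧ pos u v ⟧))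
               (sum-cong-≗ λ u → *-distribˡ-sum 2 (λ v → ⟦ (c₁ u ≡ᵇ c₂ v) ∧ pos u v ⟧))) ⟩
        cost + ∑[ u < n₁ ] ∑[ v < n₂ ] (2 * ⟦ (c₁ u ≡ᵇ c₂ v) ∧ pos u v ⟧)
          ≡⟨ ∑∑-distrib-+ (λ u v → edgeCost (pos u v) (c₁ u) (c₂ v)) (λ u v → 2 * ⟦ (c₁ u ≡ᵇ c₂ v) ∧ pos u v ⟧) ⟨
        ∑[ u < n₁ ] ∑[ v < n₂ ] (edgeCost (pos u v) (c₁ u) (c₂ v) + 2 * ⟦ (c₁ u ≡ᵇ c₂ v) ∧ pos u v ⟧)
          ≡⟨ sum-cong-≗ (λ u → sum-cong-≗ λ v → edgeCost-identity (pos u v) (c₁ u) (c₂ v)) ⟩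
        ∑[ u < n₁ ] ∑[ v < n₂ ] (⟦ pos u v ⟧ + ⟦ c₁ u ≡ᵇ c₂ v ⟧)
          ≡⟨ ∑∑-distrib-+ (λ u v → ⟦ pos u v ⟧) (λ u v → ⟦ c₁ u ≡ᵇ c₂ v ⟧) ⟩
        P + S ∎
        where open ≡-Reasoning

      ∑incidences≡K : ∑[ l < M ] incidences pos (cluster₁ l) (cluster₂ l) ≡ K
      ∑incidences≡K = begin
        ∑[ l < M ] ∑[ u < n₁ ] ∑[ v < n₂ ] ⟦ cluster₁ l u ∧ (cluster₂ l v ∧ pos u v) ⟧
          ≡⟨ ∑-comm (λ l u → ∑[ v < n₂ ] ⟦ cluster₁ l u ∧ (cluster₂ l v ∧ pos u v) ⟧) ⟩
        ∑[ u < n₁ ] ∑[ l < M ] ∑[ v < n₂ ] ⟦ cluster₁ l u ∧ (cluster₂ l v ∧ pos u v) ⟧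
          ≡⟨ sum-cong-≗ (λ u → ∑-comm (λ l v → ⟦ cluster₁ l u ∧ (cluster₂ l v ∧ pos u v) ⟧)) ⟩
        ∑[ u < n₁ ] ∑[ v < n₂ ] ∑[ l < M ] ⟦ cluster₁ l u ∧ (cluster₂ l v ∧ pos u v) ⟧
          ≡⟨ sum-cong-≗ (λ u → sum-cong-≗ λ v →
               trans (sum-cong-≗ {M} λ l → ⟦∧⟧ (cluster₁ l u) (cluster₂ l v ∧ pos u v))
                     (sum-sameLabel (c₁ u) (c₂ v) (λ b → ⟦ b ∧ pos u v ⟧) (c₁<M u))) ⟩
        K ∎
        where open ≡-Reasoning

      ∑products≡S : ∑[ l < M ] (size (cluster₁ l) * size (cluster₂ l)) ≡ S
      ∑products≡S = begin
        ∑[ l < M ] (size (cluster₁ l) * size (cluster₂ l))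
          ≡⟨ sum-cong-≗ (λ l → sum-*-sum (⟦_⟧ ∘ cluster₁ l) (⟦_⟧ ∘ cluster₂ l)) ⟩
        ∑[ l < M ] ∑[ u < n₁ ] ∑[ v < n₂ ] (⟦ cluster₁ l u ⟧ * ⟦ cluster₂ l v ⟧)
          ≡⟨ ∑-comm (λ l u → ∑[ v < n₂ ] (⟦ cluster₁ l u ⟧ * ⟦ cluster₂ l v ⟧)) ⟩
        ∑[ u < n₁ ] ∑[ l < M ] ∑[ v < n₂ ] (⟦ cluster₁ l u ⟧ * ⟦ cluster₂ l v ⟧)
          ≡⟨ sum-cong-≗ (λ u → ∑-comm (λ l v → ⟦ cluster₁ l u ⟧ * ⟦ cluster₂ l v ⟧)) ⟩
        ∑[ u < n₁ ] ∑[ v < n₂ ] ∑[ l < M ] (⟦ cluster₁ l u ⟧ * ⟦ cluster₂ l v ⟧)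
          ≡⟨ sum-cong-≗ (λ u → sum-cong-≗ λ v → sum-sameLabel (c₁ u) (c₂ v) ⟦_⟧ (c₁<M u)) ⟩
        S ∎
        where open ≡-Reasoning

      2K≤S+n₁+n₂ : 2 * K ≤ S + n₁ + n₂
      2K≤S+n₁+n₂ = begin
        2 * K
          ≡⟨ cong (2 *_) ∑incidences≡K ⟨
        2 * ∑[ l < M ] incidences pos (cluster₁ l) (cluster₂ l)
          ≡⟨ *-distribˡ-sum 2 (λ l → incidences pos (cluster₁ l) (cluster₂ l)) ⟩
        ∑[ l < M ] (2 * incidences pos (cluster₁ l) (cluster₂ l))
          ≤⟨ sum-mono-≤ {M} (λ l → incidences-bound {inc = pos} linear (cluster₁ l) (cluster₂ l)) ⟩
        ∑[ l < M ] (size (cluster₁ l) * size (cluster₂ l) + size (cluster₁ l) + size (cluster₂ l))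
          ≡⟨ ∑-distrib-+ (λ l → size (cluster₁ l) * size (cluster₂ l) + size (cluster₁ l)) (size ∘ cluster₂) ⟩
        ∑[ l < M ] (size (cluster₁ l) * size (cluster₂ l) + size (cluster₁ l)) + ∑[ l < M ] size (cluster₂ l)
          ≡⟨ cong (_+ ∑[ l < M ] size (cluster₂ l))
               (∑-distrib-+ (λ l → size (cluster₁ l) * size (cluster₂ l)) (size ∘ cluster₁)) ⟩
        ∑[ l < M ] (size (cluster₁ l) * size (cluster₂ l)) + ∑[ l < M ] size (cluster₁ l) + ∑[ l < M ] size (cluster₂ l)
          ≡⟨ cong₂ (λ x y → x + y + ∑[ l < M ] size (cluster₂ l)) ∑products≡S (∑-cluster-sizes c₁ c₁<M) ⟩
        S + n₁ + ∑[ l < M ] size (cluster₂ l)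
          ≡⟨ cong (S + n₁ +_) (∑-cluster-sizes c₂ c₂<M) ⟩
        S + n₁ + n₂ ∎
        where open ≤-Reasoning

    positive≤cost+size : ∑[ u < n₁ ] ∑[ v < n₂ ] ⟦ pos u v ⟧ ≤
                         ∑[ u < n₁ ] ∑[ v < n₂ ] edgeCost (pos u v) (c₁ u) (c₂ v) + (n₁ + n₂)
    positive≤cost+size = +-cancelʳ-≤ (2 * K) P (cost + (n₁ + n₂)) (begin
      P + 2 * K                ≤⟨ +-monoʳ-≤ P 2K≤S+n₁+n₂ ⟩
      P + (S + n₁ + n₂)        ≡⟨ regroup P S n₁ n₂ ⟩
      P + S + n₁ + n₂          ≡⟨ cong (λ x → x + n₁ + n₂) cost+2K≡P+S ⟨
      cost + 2 * K + n₁ + n₂   ≡⟨ regroup′ cost (2 * K) n₁ n₂ ⟩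
      cost + (n₁ + n₂) + 2 * K ∎)
      where
      open ≤-Reasoning
      regroup : ∀ p s a b → p + (s + a + b) ≡ p + s + a + b
      regroup = solve-∀
      regroup′ : ∀ c k a b → c + k + a + b ≡ c + (a + b) + k
      regroup′ = solve-∀

  -- The fractional solution

  edgeLevel : Bool → ℕ
  edgeLevel true = 1
  edgeLevel false = 3

  1≤edgeLevel : ∀ s → 1 ≤ edgeLevel s
  1≤edgeLevel true = ≤-refl
  1≤edgeLevel false = s≤s z≤n

  edgeLevel≤3 : ∀ s → edgeLevel s ≤ 3
  edgeLevel≤3 true = s≤s z≤n
  edgeLevel≤3 false = ≤-refl

  sideLevel : ∀ {n} → Fin n → Fin n → ℕ
  sideLevel i i' with i Fin.≟ i'
  ... | yes _ = 0
  ... | no _ = 2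

  sideLevel-self : ∀ {n} (i : Fin n) → sideLevel i i ≡ 0
  sideLevel-self i with i Fin.≟ i
  ... | yes _ = refl
  ... | no i≢i = ⊥-elim (i≢i refl)

  sideLevel-cases : ∀ {n} (i i' : Fin n) → i ≡ i' ⊎ sideLevel i i' ≡ 2
  sideLevel-cases i i' with i Fin.≟ i'
  ... | yes i≡i' = inj₁ i≡i'
  ... | no _ = inj₂ refl

  sideLevel≤2 : ∀ {n} (i i' : Fin n) → sideLevel i i' ≤ 2
  sideLevel≤2 i i' with sideLevel-cases i i'
  ... | inj₁ refl rewrite sideLevel-self i = z≤n
  ... | inj₂ distant = ≤-reflexive distant

  sideLevel-sym : ∀ {n} (i i' : Fin n) → sideLevel i i' ≡ sideLevel i' i
  sideLevel-sym i i' with sideLevel-cases i i' | sideLevel-cases i' i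
  ... | inj₁ refl | _ = refl
  ... | _ | inj₁ refl = refl
  ... | inj₂ distant | inj₂ distant' = trans distant (sym distant')

  sideLevel-triangle : ∀ {n} (i i' i'' : Fin n) → sideLevel i i'' ≤ sideLevel i i' + sideLevel i' i''
  sideLevel-triangle i i' i'' with sideLevel-cases i i'
  ... | inj₁ refl rewrite sideLevel-self i = ≤-refl
  ... | inj₂ distant rewrite distant = ≤-trans (sideLevel≤2 i i'') (m≤m+n 2 _)

  edgeLevel-triangle : ∀ {n} (s : Fin n → Bool) i i' → edgeLevel (s i) ≤ sideLevel i i' + edgeLevel (s i')
  edgeLevel-triangle s i i' with sideLevel-cases i i'
  ... | inj₁ refl rewrite sideLevel-self i = ≤-refl
  ... | inj₂ distant rewrite distant = ≤-trans (edgeLevel≤3 (s i)) (+-monoʳ-≤ 2 (1≤edgeLevel (s i')))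

  edgeLevel-triangle′ : ∀ {n} (s : Fin n → Bool) i i' → edgeLevel (s i) ≤ edgeLevel (s i') + sideLevel i' i
  edgeLevel-triangle′ s i i' = ≤-trans (edgeLevel-triangle s i i')
    (≤-reflexive (trans (cong (_+ edgeLevel (s i')) (sideLevel-sym i i')) (+-comm (sideLevel i' i) _)))

  sideLevel≤edgeLevel+edgeLevel : ∀ {n} (i i' : Fin n) s s' → sideLevel i i' ≤ edgeLevel s + edgeLevel s'
  sideLevel≤edgeLevel+edgeLevel i i' s s' =
    ≤-trans (sideLevel≤2 i i') (+-mono-≤ (1≤edgeLevel s) (1≤edgeLevel s'))

  module _ (I : CBInstance) where

    open CBInstance I

    level : Vertex I → Vertex I → ℕ
    level (inj₁ i) (inj₁ i') = sideLevel i i'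
    level (inj₂ j) (inj₂ j') = sideLevel j j'
    level (inj₁ i) (inj₂ j) = edgeLevel (sign i j)
    level (inj₂ j) (inj₁ i) = edgeLevel (sign i j)

    level-self : ∀ u → level u u ≡ 0
    level-self (inj₁ i) = sideLevel-self i
    level-self (inj₂ j) = sideLevel-self j

    level-sym : ∀ u v → level u v ≡ level v u
    level-sym (inj₁ i) (inj₁ i') = sideLevel-sym i i'
    level-sym (inj₂ j) (inj₂ j') = sideLevel-sym j j'
    level-sym (inj₁ i) (inj₂ j) = refl
    level-sym (inj₂ j) (inj₁ i) = refl

    level≤3 : ∀ u v → level u v ≤ 3
    level≤3 (inj₁ i) (inj₁ i') = ≤-trans (sideLevel≤2 i i') (n≤1+n 2)
    level≤3 (inj₂ j) (inj₂ j') = ≤-trans (sideLevel≤2 j j') (n≤1+n 2)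
    level≤3 (inj₁ i) (inj₂ j) = edgeLevel≤3 (sign i j)
    level≤3 (inj₂ j) (inj₁ i) = edgeLevel≤3 (sign i j)

    level-triangle : ∀ u v w → level u w ≤ level u v + level v w
    level-triangle (inj₁ i) (inj₁ i') (inj₁ i'') = sideLevel-triangle i i' i''
    level-triangle (inj₂ j) (inj₂ j') (inj₂ j'') = sideLevel-triangle j j' j''
    level-triangle (inj₁ i) (inj₁ i') (inj₂ j) = edgeLevel-triangle (λ z → sign z j) i i'
    level-triangle (inj₂ j) (inj₂ j') (inj₁ i) = edgeLevel-triangle (sign i) j j'
    level-triangle (inj₁ i) (inj₂ j) (inj₂ j') = edgeLevel-triangle′ (sign i) j' j
    level-triangle (inj₂ j) (inj₁ i) (inj₁ i') = edgeLevel-triangle′ (λ z → sign z j) i' i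
    level-triangle (inj₁ i) (inj₂ j) (inj₁ i') = sideLevel≤edgeLevel+edgeLevel i i' (sign i j) (sign i' j)
    level-triangle (inj₂ j) (inj₁ i) (inj₂ j') = sideLevel≤edgeLevel+edgeLevel j j' (sign i j) (sign i j')

    standardLP : Vertex I → Vertex I → ℚ.ℚ
    standardLP u v = thirds (level u v)

    standardLP-feasible : LPFeasible I standardLP
    standardLP-feasible =
      (λ u v → cong thirds (level-sym u v)) ,
      (λ u → cong thirds (level-self u)) ,
      (λ u v → thirds-mono-≤ {0} {level u v} z≤n) ,
      (λ u v → thirds-mono-≤ (level≤3 u v)) ,
      (λ u v w → ℚ.≤-trans (thirds-mono-≤ (level-triangle u v w)) (ℚ.≤-reflexive (thirds-+ (level u v) (level v w))))

    positiveEdges : ℕ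
    positiveEdges = Σℕ n₁ λ i → Σℕ n₂ λ j → ⟦ sign i j ⟧

    standardLP-objective : LPObjective I standardLP ≡ thirds positiveEdges
    standardLP-objective = Σℚ-thirds n₁ _ λ i → Σℚ-thirds n₂ _ λ j → edgeTerm (sign i j)
      where
      edgeTerm : ∀ s → (if s then thirds (edgeLevel s) else ℚ.1ℚ ℚ.- thirds (edgeLevel s)) ≡ thirds ⟦ s ⟧
      edgeTerm true = refl
      edgeTerm false = refl

    clusterCost-lower-bound : Linear sign → (c : Clustering I) → positiveEdges ≤ clusterCost I c + (n₁ + n₂)
    clusterCost-lower-bound linear c = subst₂ (λ P C → P ≤ C + (n₁ + n₂))
      (sym (Σℕ²≡∑∑ λ i j → ⟦ sign i j ⟧))
      (sym (Σℕ²≡∑∑ λ i j → edgeCost (sign i j) (c (inj₁ i)) (c (inj₂ j))))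
      (positive≤cost+size linear (c ∘ inj₁) (c ∘ inj₂))

  -- Lines and points of a grid

  affine-agree-twice : ∀ {m c m' c' x x'} → x < x' →
    m * x + c ≡ m' * x + c' → m * x' + c ≡ m' * x' + c' → m ≡ m' × c ≡ c'
  affine-agree-twice {m} {c} {m'} {c'} {x} x<x' at-x at-x' with e , refl ← m≤n⇒∃[o]m+o≡n x<x' =
    m≡m' , +-cancelˡ-≡ (m' * x) c c' (subst (λ z → z * x + c ≡ m' * x + c') m≡m' at-x)
    where
    split : ∀ m x c e → m * (suc x + e) + c ≡ (m * x + c) + m * suc e
    split = solve-∀
    m≡m' : m ≡ m'
    m≡m' = *-cancelʳ-≡ m m' (suc e) (+-cancelˡ-≡ (m * x + c) _ _ (begin
      (m * x + c) + m * suc e     ≡⟨ split m x c e ⟨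
      m * (suc x + e) + c         ≡⟨ at-x' ⟩
      m' * (suc x + e) + c'       ≡⟨ split m' x c' e ⟩
      (m' * x + c') + m' * suc e  ≡⟨ cong (_+ m' * suc e) at-x ⟨
      (m * x + c) + m' * suc e    ∎))
      where open ≡-Reasoning

  remQuot-injective : ∀ {m} n {i j : Fin (m * n)} →
    toℕ (proj₁ (remQuot {m} n i)) ≡ toℕ (proj₁ (remQuot {m} n j)) →
    toℕ (proj₂ (remQuot {m} n i)) ≡ toℕ (proj₂ (remQuot {m} n j)) → i ≡ j
  remQuot-injective {m} n {i} {j} eq₁ eq₂ = begin
    i                                 ≡⟨ Fin.combine-remQuot {m} n i ⟨
    uncurry combine (remQuot {m} n i) ≡⟨ cong₂ combine (Fin.toℕ-injective eq₁) (Fin.toℕ-injective eq₂) ⟩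
    uncurry combine (remQuot {m} n j) ≡⟨ Fin.combine-remQuot {m} n j ⟩
    j                                 ∎
    where open ≡-Reasoning

  module Grid (k : ℕ) where

    lines points : ℕ
    lines = k * (k * k)
    points = k * (2 * (k * k))

    slope : Fin lines → ℕ
    slope u = toℕ (proj₁ (remQuot {k} (k * k) u))

    intercept : Fin lines → ℕ
    intercept u = toℕ (proj₂ (remQuot {k} (k * k) u))

    abscissa : Fin points → ℕ
    abscissa v = toℕ (proj₁ (remQuot {k} (2 * (k * k)) v))

    ordinate : Fin points → ℕ
    ordinate v = toℕ (proj₂ (remQuot {k} (2 * (k * k)) v))

    onLine : Fin lines → Fin points → Bool
    onLine u v = slope u * abscissa v + intercept u ≡ᵇ ordinate v

    grid : CBInstance
    grid = record { n₁ = lines ; n₂ = points ; sign = onLine }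

    onLine⇒≡ : ∀ {u v} → T (onLine u v) → slope u * abscissa v + intercept u ≡ ordinate v
    onLine⇒≡ {u} {v} = ≡ᵇ⇒≡ (slope u * abscissa v + intercept u) (ordinate v)

    onLine-agree : ∀ {u u' w} → T (onLine u w) → T (onLine u' w) →
      slope u * abscissa w + intercept u ≡ slope u' * abscissa w + intercept u'
    onLine-agree u∋w u'∋w = trans (onLine⇒≡ u∋w) (sym (onLine⇒≡ u'∋w))

    line-ext : ∀ {u u'} → slope u ≡ slope u' × intercept u ≡ intercept u' → u ≡ u'
    line-ext (same-slope , same-intercept) = remQuot-injective {k} (k * k) same-slope same-intercept

    lines-meet-once : ∀ {u u' v v'} → u ≢ u' →
      T (onLine u v ∧ onLine u' v) → T (onLine u v' ∧ onLine u' v') → v ≡ v'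
    lines-meet-once {u} {u'} {v} {v'} u≢u' uu'∋v uu'∋v'
      with u∋v , u'∋v ← Bool.T-∧ .Equivalence.to uu'∋v | u∋v' , u'∋v' ← Bool.T-∧ .Equivalence.to uu'∋v'
      with <-cmp (abscissa v) (abscissa v')
    ... | tri≈ _ same-x _ = remQuot-injective {k} (2 * (k * k)) same-x (begin
      ordinate v                          ≡⟨ onLine⇒≡ u∋v ⟨
      slope u * abscissa v + intercept u  ≡⟨ cong (λ x → slope u * x + intercept u) same-x ⟩
      slope u * abscissa v' + intercept u ≡⟨ onLine⇒≡ u∋v' ⟩
      ordinate v'                         ∎)
      where open ≡-Reasoning
    ... | tri< x<x' _ _ =
      ⊥-elim (u≢u' (line-ext (affine-agree-twice x<x' (onLine-agree u∋v u'∋v) (onLine-agree u∋v' u'∋v'))))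
    ... | tri> _ _ x'<x =
      ⊥-elim (u≢u' (line-ext (affine-agree-twice x'<x (onLine-agree u∋v' u'∋v') (onLine-agree u∋v u'∋v))))

    onLine-linear : Linear onLine
    onLine-linear u≢u' = sum-unique≤1 _ (λ v v' → lines-meet-once u≢u')

    height<2k² : ∀ u (x : Fin k) → slope u * toℕ x + intercept u < 2 * (k * k)
    height<2k² u x = begin-strict
      slope u * toℕ x + intercept u
        ≤⟨ +-monoˡ-≤ (intercept u) (*-mono-≤ (<⇒≤ (Fin.toℕ<n (proj₁ (remQuot {k} (k * k) u)))) (<⇒≤ (Fin.toℕ<n x))) ⟩
      k * k + intercept u
        <⟨ +-monoʳ-< (k * k) (Fin.toℕ<n (proj₂ (remQuot {k} (k * k) u))) ⟩
      k * k + k * k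
        ≡⟨ cong (k * k +_) (+-identityʳ (k * k)) ⟨
      2 * (k * k) ∎
      where open ≤-Reasoning

    points-on-line : ∀ u → ∑[ v < points ] ⟦ onLine u v ⟧ ≡ k
    points-on-line u = begin
      ∑[ v < points ] ⟦ onLine u v ⟧
        ≡⟨ sum-combine k (2 * (k * k)) (⟦_⟧ ∘ onLine u) ⟩
      ∑[ x < k ] ∑[ y < 2 * (k * k) ] ⟦ onLine u (combine x y) ⟧
        ≡⟨ sum-cong-≗ {k} (λ x → sum-cong-≗ {2 * (k * k)} λ y →
             cong (λ p → ⟦ slope u * toℕ (proj₁ p) + intercept u ≡ᵇ toℕ (proj₂ p) ⟧) (Fin.remQuot-combine x y)) ⟩
      ∑[ x < k ] ∑[ y < 2 * (k * k) ] ⟦ slope u * toℕ x + intercept u ≡ᵇ toℕ y ⟧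
        ≡⟨ sum-cong-≗ (λ x → sum-indicator-1 _ (height<2k² u x)) ⟩
      ∑[ x < k ] 1
        ≡⟨ trans (sum-const k 1) (*-identityʳ k) ⟩
      k ∎
      where open ≡-Reasoning

    positiveEdges-grid : positiveEdges grid ≡ lines * k
    positiveEdges-grid = begin
      positiveEdges grid                            ≡⟨ Σℕ²≡∑∑ (λ u v → ⟦ onLine u v ⟧) ⟩
      ∑[ u < lines ] ∑[ v < points ] ⟦ onLine u v ⟧ ≡⟨ sum-cong-≗ points-on-line ⟩
      ∑[ u < lines ] k                              ≡⟨ sum-const lines k ⟩
      lines * k                                     ∎
      where open ≡-Reasoning

    1≤positiveEdges-grid : 1 ≤ k → 1 ≤ positiveEdges grid
    1≤positiveEdges-grid 1≤k =
      subst (1 ≤_) (sym positiveEdges-grid) (*-mono-≤ (*-mono-≤ 1≤k (*-mono-≤ 1≤k 1≤k)) 1≤k)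

    positiveEdges-grid-scaled : ∀ {d} → k ≡ 9 * d → positiveEdges grid ≡ 3 * (d * (lines + points))
    positiveEdges-grid-scaled {d} refl = trans positiveEdges-grid (identity d)
      where
      identity : ∀ d → 9 * d * (9 * d * (9 * d)) * (9 * d) ≡
                       3 * (d * (9 * d * (9 * d * (9 * d)) + 9 * d * (2 * (9 * d * (9 * d)))))
      identity = solve-∀

open import Data.Nat as ℕ using (suc; s≤s; z≤n)
open import Data.Rational using (ℚ; 0ℚ; _<_; _≤_; _*_; _-_)
open Rationals using (0<thirds; archimedean; gap-bound)
open Counting using (positiveEdges; standardLP; standardLP-feasible; standardLP-objective; clusterCost-lower-bound; module Grid)

theorem4 : (δ : ℚ) → 0ℚ < δ →
    Σ CBInstance λ I →
    Σ (Vertex I → Vertex I → ℚ) λ x →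
      LPFeasible I x × (0ℚ < LPObjective I x) ×
      ((c : Clustering I) → (ℕ→ℚ 3 - δ) * LPObjective I x ≤ ℕ→ℚ (clusterCost I c))
theorem4 δ 0<δ with d , 1≤δd ← archimedean δ 0<δ =
  grid , standardLP grid , standardLP-feasible grid , objective-positive , integrality-gap
  where
  open Grid (9 ℕ.* suc d)

  objective-positive : 0ℚ < LPObjective grid (standardLP grid)
  objective-positive = subst (0ℚ <_) (sym (standardLP-objective grid)) (0<thirds (1≤positiveEdges-grid (s≤s z≤n)))

  integrality-gap : (c : Clustering grid) → (ℕ→ℚ 3 - δ) * LPObjective grid (standardLP grid) ≤ ℕ→ℚ (clusterCost grid c)
  integrality-gap c = subst (λ L → (ℕ→ℚ 3 - δ) * L ≤ ℕ→ℚ (clusterCost grid c)) (sym (standardLP-objective grid))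
    (gap-bound {δ} {suc d} {lines ℕ.+ points} {positiveEdges grid} {clusterCost grid c} 1≤δd (positiveEdges-grid-scaled {suc d} refl) (clusterCost-lower-bound grid onLine-linear c))
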